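{- Let $\mathcal{C}\subseteq\mathbb{N}^d$ be a positive integer cone and $S$ a $\mathcal{C}$-semigroup. Then $\operatorname{M}(S)=\{0\}$ if and only if $S=\mathcal{C}$.
   Context: For a finite $A\subseteq\mathbb{N}^d$, the positive integer cone spanned by $A$ is $\mathcal{C}=\{\sum q_ia_i: a_i\in A, q_i\in\mathbb{Q}_{\geq0}\}\cap\mathbb{N}^d$. A $\mathcal{C}$-semigroup is a finitely generated submonoid $S\subseteq\mathcal{C}$ of $(\mathbb{N}^d,+)$ with $\mathcal{C}\setminus S$ finite; $\mathcal{H}(S)=\mathcal{C}\setminus S$. $\operatorname{M}(S)=\{h\in\mathcal{H}(S): \{s\in S: h-s\in S\}=\{0\}\}\cup\{0\}$. -}

module Defs where

open import Data.Nat as ℕ using (ℕ)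
open import Data.Integer using (+_)
open import Data.Rational as ℚ using (ℚ; 0ℚ; _/_)
open import Data.Fin using (Fin; zero; suc)
open import Data.Vec using (Vec; lookup; replicate; zipWith)
open import Data.List using (List; length)
import Data.List as L
open import Data.Product using (Σ; ∃; _×_)
open import Data.Sum using (_⊎_)
open import Relation.Binary.PropositionalEquality using (_≡_)
open import Relation.Nullary using (¬_)
open import Data.List.Membership.Propositional using (_∈_)

ℕ^ : ℕ → Set
ℕ^ d = Vec ℕ d

𝟎 : ∀ {d} → ℕ^ d
𝟎 = replicate _ 0

_⊕_ : ∀ {d} → ℕ^ d → ℕ^ d → ℕ^ d
_⊕_ = zipWith ℕ._+_

ℕ→ℚ : ℕ → ℚ
ℕ→ℚ n = + n / 1

ΣℚFin : (n : ℕ) → (Fin n → ℚ) → ℚ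
ΣℚFin ℕ.zero    f = 0ℚ
ΣℚFin (ℕ.suc n) f = f zero ℚ.+ ΣℚFin n (λ i → f (suc i))

ΣℕFin : (n : ℕ) → (Fin n → ℕ) → ℕ
ΣℕFin ℕ.zero    f = 0
ΣℕFin (ℕ.suc n) f = f zero ℕ.+ ΣℕFin n (λ i → f (suc i))

-- x lies in the positive integer cone spanned by the finite set A:
-- x = Σ q_i a_i with q_i ∈ ℚ_{≥0} (x ∈ ℕ^d by typing)
InCone : ∀ {d} → List (ℕ^ d) → ℕ^ d → Set
InCone {d} A x =
  Σ (Fin (length A) → ℚ) λ q →
    (∀ i → 0ℚ ℚ.≤ q i) ×
    (∀ (j : Fin d) → ℕ→ℚ (lookup x j)
        ≡ ΣℚFin (length A) (λ i → q i ℚ.* ℕ→ℚ (lookup (L.lookup A i) j)))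

InS : ∀ {d} → List (ℕ^ d) → ℕ^ d → Set
InS {d} G x =
  Σ (Fin (length G) → ℕ) λ n →
    ∀ (j : Fin d) → lookup x j ≡ ΣℕFin (length G) (λ i → n i ℕ.* lookup (L.lookup G i) j)

InH : ∀ {d} → List (ℕ^ d) → List (ℕ^ d) → ℕ^ d → Set
InH A G x = InCone A x × ¬ InS G x

IsCSemigroup : ∀ {d} → List (ℕ^ d) → List (ℕ^ d) → Set
IsCSemigroup {d} A G =
  (∀ x → InS G x → InCone A x) ×
  ∃ λ (H : List (ℕ^ d)) → ∀ x → InH A G x → x ∈ H

-- M(S) = {h ∈ H(S) : {s ∈ S : h - s ∈ H(S)} = {0}} ∪ {0}
-- (h - s ∈ ℕ^d written as: ∃ t, s + t = h)
InM : ∀ {d} → List (ℕ^ d) → List (ℕ^ d) → ℕ^ d → Set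
InM A G h =
  h ≡ 𝟎 ⊎
  (InH A G h ×
   (∀ s → InS G s → (∃ λ t → (s ⊕ t ≡ h) × InH A G t) → s ≡ 𝟎))

{-# OPTIONS --safe #-}
-- If M(S) = {0} but some x ∈ C is a gap, take a gap x with minimal coordinate sum.
-- For s ∈ S∖{0} and s + t = x, the point t has smaller coordinate sum, so it is
-- not a gap; hence x ∈ M(S), i.e. x = 0 ∈ S, a contradiction. Constructively this
-- needs membership in S to be decidable, which holds because coefficients of a
-- representation of x may be bounded by the coordinate sum of x.
module Submission where

open import Defs
open import Data.Nat using (ℕ)
open import Data.List using (List)
open import Data.Product using (_×_)
open import Relation.Binary.PropositionalEquality using (_≡_)
open import Function.Bundles using (_⇔_)

open import Data.Nat using (zero; suc; _+_; _*_; _∸_; _≤_; _<_; _≟_; _≤?_; s≤s; z≤n)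
open import Data.Nat.Properties
open import Data.Nat.Induction using (<-wellFounded)
open import Algebra.Properties.CommutativeSemigroup +-commutativeSemigroup using (interchange)
open import Data.Fin using (Fin) renaming (zero to fzero; suc to fsuc)
open import Data.Fin.Properties using (all?)
open import Data.Vec using ([]; _∷_; lookup; sum)
open import Data.Vec.Properties using (≡-dec; lookup-replicate)
import Data.List as List
open import Data.Product using (Σ; ∃; _,_; proj₁; proj₂)
open import Data.Sum using (inj₁; inj₂)
open import Data.Empty using (⊥-elim)
open import Relation.Nullary using (yes; no; ¬_)
open import Relation.Nullary.Decidable using (map′; _×-dec_)
open import Relation.Unary using (Decidable)
open import Relation.Binary.PropositionalEquality using (refl; sym; trans; cong; subst; module ≡-Reasoning)
open import Induction.WellFounded using (Acc; acc)
open import Function.Bundles using (mk⇔)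

ΣℕFin-zero : ∀ m → ΣℕFin m (λ _ → 0) ≡ 0
ΣℕFin-zero zero    = refl
ΣℕFin-zero (suc m) = ΣℕFin-zero m

ΣℕFin-≤ : ∀ m (f : Fin m → ℕ) i → f i ≤ ΣℕFin m f
ΣℕFin-≤ (suc m) f fzero    = m≤m+n _ _
ΣℕFin-≤ (suc m) f (fsuc i) = ≤-trans (ΣℕFin-≤ m (λ i → f (fsuc i)) i) (m≤n+m _ _)

k*n≤b<k⇒n≡0 : ∀ {k n b} → k * n ≤ b → b < k → n ≡ 0
k*n≤b<k⇒n≡0 {n = zero}  _    _   = refl
k*n≤b<k⇒n≡0 {k} {n = suc n} k*n≤b b<k =
  ⊥-elim (<-irrefl refl (<-≤-trans b<k (≤-trans (m≤m*n k (suc n)) k*n≤b)))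

Representable : ∀ {m d} → (Fin m → Fin d → ℕ) → (Fin d → ℕ) → Set
Representable {m} gen y = Σ (Fin m → ℕ) λ n → ∀ j → y j ≡ ΣℕFin m (λ i → n i * gen i j)

module _ {m d} (gen : Fin (suc m) → Fin d → ℕ) (y : Fin d → ℕ) where

  RepresentableWithFirst : ℕ → Set
  RepresentableWithFirst k =
    (∀ j → k * gen fzero j ≤ y j) ×
    Representable (λ i → gen (fsuc i)) (λ j → y j ∸ k * gen fzero j)

  representableWithFirst⇒representable : ∀ {k} → RepresentableWithFirst k → Representable gen y
  representableWithFirst⇒representable {k} (k*g≤y , n , eq) =
    (λ { fzero → k ; (fsuc i) → n i }) ,
    λ j → trans (sym (m+[n∸m]≡n (k*g≤y j))) (cong (k * gen fzero j +_) (eq j))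

  representable⇒representableWithFirst :
    ((n , _) : Representable gen y) → RepresentableWithFirst (n fzero)
  representable⇒representableWithFirst (n , eq) =
    (λ j → subst (n fzero * gen fzero j ≤_) (sym (eq j)) (m≤m+n _ _)) ,
    (λ i → n (fsuc i)) ,
    λ j → trans (cong (_∸ n fzero * gen fzero j) (eq j)) (m+n∸m≡n (n fzero * gen fzero j) _)

  -- A first coefficient beyond the coordinate sum of y forces the first generator to
  -- vanish, and then the coefficient 0 works as well.
  representable⇒boundedFirst :
    Representable gen y → ∃ λ k → k < suc (ΣℕFin d y) × RepresentableWithFirst k
  representable⇒boundedFirst r@(n , eq) with representable⇒representableWithFirst r
  ... | withFirst@(n₀*g≤y , rest) with n fzero <? suc (ΣℕFin d y)
  ...   | yes n₀<bound = n fzero , n₀<bound , withFirst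
  ...   | no  n₀≮bound = 0 , s≤s z≤n , (λ _ → z≤n) , proj₁ rest , λ j → begin
            y j                         ≡⟨ cong (y j ∸_) (*-zeroʳ (n fzero)) ⟨
            y j ∸ n fzero * 0           ≡⟨ cong (λ g → y j ∸ n fzero * g) (first-vanishes j) ⟨
            y j ∸ n fzero * gen fzero j ≡⟨ proj₂ rest j ⟩
            ΣℕFin m (λ i → proj₁ rest i * gen (fsuc i) j) ∎
    where
    open ≡-Reasoning
    first-vanishes : ∀ j → gen fzero j ≡ 0
    first-vanishes j = k*n≤b<k⇒n≡0 (n₀*g≤y j)
      (≤-<-trans (ΣℕFin-≤ d y j) (≰⇒> (λ n₀≤ → n₀≮bound (s≤s n₀≤))))

representable? : ∀ {m d} (gen : Fin m → Fin d → ℕ) → Decidable (Representable gen)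
representable? {zero}  gen y = map′ (λ y≡0 → (λ ()) , y≡0) proj₂ (all? (λ j → y j ≟ 0))
representable? {suc m} {d} gen y =
  map′ (λ (k , _ , withFirst) → representableWithFirst⇒representable gen y {k} withFirst)
       (representable⇒boundedFirst gen y)
       (anyUpTo? withFirst? (suc (ΣℕFin d y)))
  where
  withFirst? : Decidable (RepresentableWithFirst gen y)
  withFirst? k = all? (λ j → k * gen fzero j ≤? y j) ×-dec representable? _ _

sum-⊕ : ∀ {d} (s t : ℕ^ d) → sum (s ⊕ t) ≡ sum s + sum t
sum-⊕ []      []      = refl
sum-⊕ (a ∷ s) (b ∷ t) = trans (cong (a + b +_) (sum-⊕ s t)) (interchange a b (sum s) (sum t))

sum≡0⇒≡𝟎 : ∀ {d} (s : ℕ^ d) → sum s ≡ 0 → s ≡ 𝟎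
sum≡0⇒≡𝟎 []          _   = refl
sum≡0⇒≡𝟎 (zero ∷ s)  eq  = cong (0 ∷_) (sum≡0⇒≡𝟎 s eq)
sum≡0⇒≡𝟎 (suc _ ∷ _) ()

sum-⊕-< : ∀ {d} (s t : ℕ^ d) → ¬ s ≡ 𝟎 → sum t < sum (s ⊕ t)
sum-⊕-< s t s≢𝟎 = subst (sum t <_) (sym (sum-⊕ s t))
  (m<n+m (sum t) (n≢0⇒n>0 (λ sum≡0 → s≢𝟎 (sum≡0⇒≡𝟎 s sum≡0))))

module _ {d} (A G : List (ℕ^ d)) where

  InS? : Decidable (InS G)
  InS? x = representable? (λ i → lookup (List.lookup G i)) (lookup x)

  InS-𝟎 : InS G 𝟎
  InS-𝟎 = (λ _ → 0) , λ j → trans (lookup-replicate j 0) (sym (ΣℕFin-zero (List.length G)))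

  InH⇒InM : ∀ {x} → (∀ y → sum y < sum x → InCone A y → InS G y) → InH A G x → InM A G x
  InH⇒InM {x} smaller⊆S x∈H = inj₂ (x∈H , minimal)
    where
    minimal : ∀ s → InS G s → (∃ λ t → (s ⊕ t ≡ x) × InH A G t) → s ≡ 𝟎
    minimal s _ (t , s⊕t≡x , t∈C , t∉S) with ≡-dec _≟_ s 𝟎
    ... | yes s≡𝟎 = s≡𝟎
    ... | no  s≢𝟎 = ⊥-elim (t∉S (smaller⊆S t t<x t∈C))
      where
      t<x : sum t < sum x
      t<x = subst (λ u → sum t < sum u) s⊕t≡x (sum-⊕-< s t s≢𝟎)

  M-trivial⇒C⊆S : (∀ x → InM A G x → x ≡ 𝟎) → ∀ x → InCone A x → InS G x
  M-trivial⇒C⊆S M⊆𝟎 x = go x (<-wellFounded (sum x))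
    where
    go : ∀ x → Acc _<_ (sum x) → InCone A x → InS G x
    go x (acc smaller) x∈C with InS? x
    ... | yes x∈S = x∈S
    ... | no  x∉S = ⊥-elim (x∉S (subst (InS G) (sym x≡𝟎) InS-𝟎))
      where
      x≡𝟎 : x ≡ 𝟎
      x≡𝟎 = M⊆𝟎 x (InH⇒InM (λ y y<x → go y (smaller y<x)) (x∈C , x∉S))

  C⊆S⇒M-trivial : (∀ x → InCone A x → InS G x) → ∀ x → InM A G x → x ≡ 𝟎
  C⊆S⇒M-trivial C⊆S x (inj₁ x≡𝟎)               = x≡𝟎
  C⊆S⇒M-trivial C⊆S x (inj₂ ((x∈C , x∉S) , _)) = ⊥-elim (x∉S (C⊆S x x∈C))

proposition2p4 : (d : ℕ) (A G : List (ℕ^ d)) → IsCSemigroup A G →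
    ((∀ x → (InM A G x → x ≡ 𝟎) × (x ≡ 𝟎 → InM A G x))
      ⇔ (∀ x → (InS G x → InCone A x) × (InCone A x → InS G x)))
proposition2p4 d A G (S⊆C , _) = mk⇔
  (λ M-trivial x → S⊆C x , M-trivial⇒C⊆S A G (λ y → proj₁ (M-trivial y)) x)
  (λ S≡C x → C⊆S⇒M-trivial A G (λ y → proj₂ (S≡C y)) x , inj₁)
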